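{- Let $n\ge0$ and $0\le i<3^n$. If $C_n(i)=1$ or $C_n(i)$ is a strict local maximum of $C_n$, then $(C_{n+1}(3i),C_{n+1}(3i+1),C_{n+1}(3i+2))=(C_n(i),3C_n(i),C_n(i))$. Otherwise $(C_{n+1}(3i),C_{n+1}(3i+1),C_{n+1}(3i+2))=(C_n(i)/3,C_n(i)/3,C_n(i)/3)$.
   Context: The unit weight-$3$ Stern–Brocot sequences $SB_n$ ($n\ge0$): $SB_0=(\frac{0}{1},\frac{1}{1})$, and $SB_{n+1}$ is obtained from $SB_n$ by keeping all its terms in order and inserting, between each pair of consecutive terms $\frac{p}{q},\frac{r}{s}$ (in lowest terms, positive denominators), the two fractions $\frac{2p+r}{2q+s}$ and $\frac{p+2r}{q+2s}$, each reduced to lowest terms, in this order. $SB_n$ has $3^n+1$ terms, indexed from $0$. For $0\le i<3^n$, $C_n(i)=qr-ps$ where $\frac{p}{q}$ and $\frac{r}{s}$ are the $i$-th and $(i+1)$-th terms of $SB_n$ in lowest terms with positive denominators. $C_n(i)$ is a strict local maximum if $C_n(i)>C_n(j)$ for each $j\in\{i-1,i+1\}$ with $0\le j<3^n$. -}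

module Defs where

open import Data.Nat using (ℕ; zero; suc; _+_; _*_; _^_; _<_; _/_)
open import Data.Nat.GCD using (gcd)
open import Data.Integer as ℤ using (ℤ; +_; _-_)
open import Data.List using (List; []; _∷_)
open import Data.Product using (_×_; _,_)
open import Data.Sum using (_⊎_)
open import Relation.Binary.PropositionalEquality using (_≡_)

-- A fraction p/q represented by the pair (p , q) of naturals (all terms of
-- SB_n lie in [0,1], so numerators are nonnegative and denominators positive).
Frac : Set
Frac = ℕ × ℕ

-- Reduce to lowest terms by dividing by gcd (gcd is nonzero since q > 0).
reduce : ℕ → ℕ → Frac
reduce p q with gcd p q
... | zero  = p , q
... | suc g = p / suc g , q / suc g

left right : Frac → Frac → Frac
left  (p , q) (r , s) = reduce (2 * p + r) (2 * q + s)
right (p , q) (r , s) = reduce (p + 2 * r) (q + 2 * s)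

step : List Frac → List Frac
step []                    = []
step (x ∷ [])              = x ∷ []
step (x ∷ xs@(y ∷ _))      = x ∷ left x y ∷ right x y ∷ step xs

SB : ℕ → List Frac
SB zero    = (0 , 1) ∷ (1 , 1) ∷ []
SB (suc n) = step (SB n)

-- i-th entry of a list (default 0/1 out of range; only used in range).
nth : List Frac → ℕ → Frac
nth []       _       = 0 , 1
nth (x ∷ _)  zero    = x
nth (_ ∷ xs) (suc i) = nth xs i

det : Frac → Frac → ℤ
det (p , q) (r , s) = (+ q) ℤ.* (+ r) - (+ p) ℤ.* (+ s)

C : ℕ → ℕ → ℤ
C n i = det (nth (SB n) i) (nth (SB n) (suc i))

StrictLocalMax : ℕ → ℕ → Set
StrictLocalMax n i =
  ∀ j → j < 3 ^ n → (suc j ≡ i ⊎ j ≡ suc i) → C n j ℤ.< C n i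

{-# OPTIONS --safe #-}
module Submission where

-- View a consecutive pair a, b of SB_n as vectors in ℤ² with determinant d = det(a, b).
-- Every such pair is balanced (d divides a + b) or progressive (d divides b - a), and d = 3^k.
-- For a balanced pair, a + b = d t with det(a, t) = 1; then t pairs with 2a + b and a + 2b to
-- determinant ±1, so both inserted fractions are already reduced, and the new determinants are
-- d, 3d, d with the middle pair balanced and the outer pairs progressive.  For a progressive pair
-- with d = 3e, b - a = d t with det(a, t) = 1, so 2a + b and a + 2b reduce by exactly 3 and the
-- four terms a, a + e t, a + 2e t, b form an arithmetic progression whose three pairs are
-- progressive with determinant e.  By induction, a pair with C > 1 is balanced exactly when C is a
-- strict local maximum there: the middle child of a balanced pair exceeds both its neighbours,
-- and every progressive child has a neighbour at least as large.

open import Defs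
open import Data.Nat using (ℕ; zero; suc; _^_; _<_; _≤_; s≤s; z≤n)
open import Data.Integer as ℤ using (ℤ; +_)
open import Data.Product using (_×_; _,_; proj₁; proj₂; Σ-syntax)
open import Data.Sum using (_⊎_; inj₁; inj₂)
open import Data.List using ([]; _∷_; length)
open import Relation.Nullary using (¬_; contradiction)
open import Relation.Binary.PropositionalEquality

import Data.Nat as ℕ
import Data.Nat.Properties as ℕ
import Data.Nat.Divisibility as ℕ
open import Data.Nat.DivMod using (m*n/n≡m)
open import Data.Nat.GCD using (gcd; gcd[m,n]∣m; gcd[m,n]∣n; c*gcd[m,n]≡gcd[cm,cn])
import Data.Integer.Properties as ℤ
open import Data.Integer.Divisibility.Signed as ℤ using (divides)
open import Data.Integer.Tactic.RingSolver using (solve-∀)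

P Q : Frac → ℤ
P (p , _) = + p
Q (_ , q) = + q

module _ where
  open import Data.Integer using (_+_; _*_; -_; _-_)
  open ≡-Reasoning

  det-coords : ∀ x y {px qx py qy} → P x ≡ px → Q x ≡ qx → P y ≡ py → Q y ≡ qy →
    det x y ≡ qx * py - px * qy
  det-coords (p , q) (r , s) refl refl refl refl = refl

  Balanced Progressive : Frac → Frac → Set
  Balanced a b = det a b ℤ.∣ P a + P b × det a b ℤ.∣ Q a + Q b
  Progressive a b = det a b ℤ.∣ P b - P a × det a b ℤ.∣ Q b - Q a

  Link : ℤ → (Frac → Frac → Set) → Frac → Frac → Set
  Link w R x y = det x y ≡ w × R x y

  Unimodular : Frac → ℤ → ℤ → Set
  Unimodular x u v = Q x * u - P x * v ≡ + 1

  ∣-by : ∀ {d w z} t → d ≡ w → z ≡ t * w → d ℤ.∣ z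
  ∣-by t d≡w z≡tw = divides t (trans z≡tw (cong (t *_) (sym d≡w)))

  unit-balanced : ∀ a b → det a b ≡ + 1 → Balanced a b
  unit-balanced a b det≡1 =
    ∣-by (P a + P b) det≡1 (sym (ℤ.*-identityʳ _)) , ∣-by (Q a + Q b) det≡1 (sym (ℤ.*-identityʳ _))

  -- Reduction to lowest terms

  gcd≡1-if-unimodular : ∀ x y (u v : ℤ) → ℤ.∣ + y * u - + x * v ∣ ≡ 1 → gcd x y ≡ 1
  gcd≡1-if-unimodular x y u v unit = ℕ.∣1⇒≡1 (subst (gcd x y ℕ.∣_) unit (ℤ.∣⇒∣ᵤ gcd∣combination))
    where
    gcd∣combination : + gcd x y ℤ.∣ + y * u - + x * v
    gcd∣combination = ℤ.∣m∣n⇒∣m-n (ℤ.∣m⇒∣m*n u (ℤ.∣ᵤ⇒∣ {i = + y} (gcd[m,n]∣n x y)))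
                                  (ℤ.∣m⇒∣m*n v (ℤ.∣ᵤ⇒∣ {i = + x} (gcd[m,n]∣m x y)))

  reduce-scaled : ∀ c x y .{{_ : ℕ.NonZero c}} → gcd x y ≡ 1 → reduce (c ℕ.* x) (c ℕ.* y) ≡ (x , y)
  reduce-scaled c@(suc _) x y coprime with gcd (c ℕ.* x) (c ℕ.* y) | gcd[cx,cy]≡c
    where
    gcd[cx,cy]≡c : gcd (c ℕ.* x) (c ℕ.* y) ≡ c
    gcd[cx,cy]≡c = begin
      gcd (c ℕ.* x) (c ℕ.* y) ≡⟨ c*gcd[m,n]≡gcd[cm,cn] c x y ⟨
      c ℕ.* gcd x y           ≡⟨ cong (c ℕ.*_) coprime ⟩
      c ℕ.* 1                 ≡⟨ ℕ.*-identityʳ c ⟩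
      c                       ∎
  ... | .c | refl = cong₂ _,_ (cancel x) (cancel y)
    where
    cancel : ∀ z → c ℕ.* z ℕ./ c ≡ z
    cancel z = trans (cong (ℕ._/ c) (ℕ.*-comm c z)) (m*n/n≡m z c)

  natural-quotient : ∀ c .{{_ : ℕ.NonZero c}} X {x} → + X ≡ + c * x →
    Σ[ x′ ∈ ℕ ] X ≡ c ℕ.* x′ × + x′ ≡ x
  natural-quotient c X {x} X≡cx with ℤ.∣⇒∣ᵤ {+ c} {+ X} (divides x (trans X≡cx (ℤ.*-comm (+ c) x)))
  ... | ℕ.divides x′ X≡x′c = x′ , X≡cx′ , ℤ.*-cancelˡ-≡ (+ c) (+ x′) x (begin
    + c * + x′   ≡⟨ ℤ.pos-* c x′ ⟨
    + (c ℕ.* x′) ≡⟨ cong +_ X≡cx′ ⟨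
    + X          ≡⟨ X≡cx ⟩
    + c * x      ∎)
    where
    X≡cx′ : X ≡ c ℕ.* x′
    X≡cx′ = trans X≡x′c (ℕ.*-comm x′ c)

  reduce-unimodular : ∀ c .{{_ : ℕ.NonZero c}} X Y {x y} u v →
    + X ≡ + c * x → + Y ≡ + c * y → ℤ.∣ y * u - x * v ∣ ≡ 1 →
    P (reduce X Y) ≡ x × Q (reduce X Y) ≡ y
  reduce-unimodular c X Y u v X≡cx Y≡cy unit
    with natural-quotient c X X≡cx | natural-quotient c Y Y≡cy
  ... | x′ , refl , refl | y′ , refl , refl = cong P reduced , cong Q reduced
    where
    reduced : reduce (c ℕ.* x′) (c ℕ.* y′) ≡ (x′ , y′)
    reduced = reduce-scaled c x′ y′ (gcd≡1-if-unimodular x′ y′ u v unit)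

  left-coords : ∀ a b c .{{_ : ℕ.NonZero c}} {x y} u v →
    + 2 * P a + P b ≡ + c * x → + 2 * Q a + Q b ≡ + c * y → ℤ.∣ y * u - x * v ∣ ≡ 1 →
    P (left a b) ≡ x × Q (left a b) ≡ y
  left-coords (p , q) (r , s) c u v eqP eqQ =
    reduce-unimodular c _ _ u v (trans (pos-2m+n p r) eqP) (trans (pos-2m+n q s) eqQ)
    where
    pos-2m+n : ∀ m n → + (2 ℕ.* m ℕ.+ n) ≡ + 2 * + m + + n
    pos-2m+n m n = trans (ℤ.pos-+ (2 ℕ.* m) n) (cong (_+ + n) (ℤ.pos-* 2 m))

  right-coords : ∀ a b c .{{_ : ℕ.NonZero c}} {x y} u v →
    P a + + 2 * P b ≡ + c * x → Q a + + 2 * Q b ≡ + c * y → ℤ.∣ y * u - x * v ∣ ≡ 1 →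
    P (right a b) ≡ x × Q (right a b) ≡ y
  right-coords (p , q) (r , s) c u v eqP eqQ =
    reduce-unimodular c _ _ u v (trans (pos-m+2n p r) eqP) (trans (pos-m+2n q s) eqQ)
    where
    pos-m+2n : ∀ m n → + (m ℕ.+ 2 ℕ.* n) ≡ + m + + 2 * + n
    pos-m+2n m n = trans (ℤ.pos-+ m (2 ℕ.* n)) (cong (λ z → + m + z) (ℤ.pos-* 2 n))

  -- The pairs inserted between a balanced or a progressive pair

  det-shift : ∀ px qx u v d → qx * (px + u * d) - px * (qx + v * d) ≡ d * (qx * u - px * v)
  det-shift = solve-∀

  cross-shift : ∀ px qx u v d → (qx + v * d) * u - (px + u * d) * v ≡ qx * u - px * v
  cross-shift = solve-∀

  progression-step : ∀ x y {u v d} → Unimodular x u v → P y ≡ P x + u * d → Q y ≡ Q x + v * d →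
    Link d Progressive x y × Unimodular y u v
  progression-step x y {u} {v} {d} unimodular Py Qy =
    (det≡d , ∣-by u det≡d (difference (P x) u Py) , ∣-by v det≡d (difference (Q x) v Qy)) ,
    trans (cong₂ (λ p q → q * u - p * v) Py Qy) (trans (cross-shift (P x) (Q x) u v d) unimodular)
    where
    det≡d : det x y ≡ d
    det≡d = begin
      det x y                                   ≡⟨ det-coords x y refl refl Py Qy ⟩
      Q x * (P x + u * d) - P x * (Q x + v * d) ≡⟨ det-shift (P x) (Q x) u v d ⟩
      d * (Q x * u - P x * v)                   ≡⟨ cong (d *_) unimodular ⟩
      d * + 1                                   ≡⟨ ℤ.*-identityʳ d ⟩
      d                                         ∎
    [z+t]-z≡t : ∀ z t → (z + t) - z ≡ t
    [z+t]-z≡t = solve-∀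
    difference : ∀ {z′} z t → z′ ≡ z + t * d → z′ - z ≡ t * d
    difference z t refl = [z+t]-z≡t z (t * d)

  progressive-children : ∀ a b {d} .{{_ : ℤ.NonZero d}} → det a b ≡ + 3 * d → Progressive a b →
    let L = left a b ; R = right a b in
    Link d Progressive a L × Link d Progressive L R × Link d Progressive R b
  progressive-children a b {d} det≡3d (divides u diffP , divides v diffQ) =
    proj₁ a→L , proj₁ L→R , proj₁ R→b
    where
    L R : Frac
    L = left a b
    R = right a b
    z+[z′-z]≡z′ : ∀ z z′ → z + (z′ - z) ≡ z′
    z+[z′-z]≡z′ = solve-∀
    shifted : ∀ z z′ t → z′ - z ≡ t * det a b → z′ ≡ z + t * (+ 3 * d)
    shifted z z′ t eq = trans (sym (z+[z′-z]≡z′ z z′)) (cong (_+_ z) (trans eq (cong (t *_) det≡3d)))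
    Pb : P b ≡ P a + u * (+ 3 * d)
    Pb = shifted (P a) (P b) u diffP
    Qb : Q b ≡ Q a + v * (+ 3 * d)
    Qb = shifted (Q a) (Q b) v diffQ
    a-unimodular : Unimodular a u v
    a-unimodular = ℤ.*-cancelˡ-≡ (+ 3 * d) _ (+ 1) {{ℤ.i*j≢0 (+ 3) d}} (begin
      + 3 * d * (Q a * u - P a * v)                             ≡⟨ det-shift (P a) (Q a) u v (+ 3 * d) ⟨
      Q a * (P a + u * (+ 3 * d)) - P a * (Q a + v * (+ 3 * d)) ≡⟨ det-coords a b refl refl Pb Qb ⟨
      det a b                                                   ≡⟨ det≡3d ⟩
      + 3 * d                                                   ≡⟨ ℤ.*-identityʳ (+ 3 * d) ⟨
      + 3 * d * + 1                                             ∎)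
    thirds : ∀ z t d → z + t * (+ 3 * d) ≡ ((z + t * d) + t * d) + t * d
    thirds = solve-∀
    left-third : ∀ z t d → + 2 * z + (z + t * (+ 3 * d)) ≡ + 3 * (z + t * d)
    left-third = solve-∀
    right-third : ∀ z t d → z + + 2 * (z + t * (+ 3 * d)) ≡ + 3 * ((z + t * d) + t * d)
    right-third = solve-∀
    coord-L : ∀ z {z′} t → z′ ≡ z + t * (+ 3 * d) → + 2 * z + z′ ≡ + 3 * (z + t * d)
    coord-L z t refl = left-third z t d
    coord-R : ∀ z {z′ zL} t → z′ ≡ z + t * (+ 3 * d) → zL ≡ z + t * d →
      z + + 2 * z′ ≡ + 3 * (zL + t * d)
    coord-R z t refl refl = right-third z t d
    coord-b : ∀ z {z′ zL zR} t → z′ ≡ z + t * (+ 3 * d) → zL ≡ z + t * d → zR ≡ zL + t * d →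
      z′ ≡ zR + t * d
    coord-b z t refl refl refl = thirds z t d
    coords-L : P L ≡ P a + u * d × Q L ≡ Q a + v * d
    coords-L = left-coords a b 3 u v (coord-L (P a) u Pb) (coord-L (Q a) v Qb)
      (cong ℤ.∣_∣ (trans (cross-shift (P a) (Q a) u v d) a-unimodular))
    a→L : Link d Progressive a L × Unimodular L u v
    a→L = progression-step a L a-unimodular (proj₁ coords-L) (proj₂ coords-L)
    coords-R : P R ≡ P L + u * d × Q R ≡ Q L + v * d
    coords-R = right-coords a b 3 u v
      (coord-R (P a) u Pb (proj₁ coords-L)) (coord-R (Q a) v Qb (proj₂ coords-L))
      (cong ℤ.∣_∣ (trans (cross-shift (P L) (Q L) u v d) (proj₂ a→L)))
    L→R : Link d Progressive L R × Unimodular R u v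
    L→R = progression-step L R (proj₂ a→L) (proj₁ coords-R) (proj₂ coords-R)
    R→b : Link d Progressive R b × Unimodular b u v
    R→b = progression-step R b (proj₂ L→R)
      (coord-b (P a) u Pb (proj₁ coords-L) (proj₁ coords-R))
      (coord-b (Q a) v Qb (proj₂ coords-L) (proj₂ coords-R))

  balanced-inserted : ∀ a b {w} .{{_ : ℤ.NonZero w}} → det a b ≡ w → Balanced a b →
      (P (left a b) ≡ + 2 * P a + P b × Q (left a b) ≡ + 2 * Q a + Q b)
    × (P (right a b) ≡ P a + + 2 * P b × Q (right a b) ≡ Q a + + 2 * Q b)
  balanced-inserted a b {w} det≡w (divides u sumP , divides v sumQ) =
    left-coords a b 1 u v (sym (ℤ.*-identityˡ _)) (sym (ℤ.*-identityˡ _)) (cong ℤ.∣_∣ L-unimodular) ,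
    right-coords a b 1 u v (sym (ℤ.*-identityˡ _)) (sym (ℤ.*-identityˡ _)) (cong ℤ.∣_∣ R-unimodular)
    where
    scale : ∀ x y u v w → w * (y * u - x * v) ≡ y * (u * w) - x * (v * w)
    scale = solve-∀
    pairing : ∀ x y → w * (y * u - x * v) ≡ y * (P a + P b) - x * (Q a + Q b)
    pairing x y = trans (scale x y u v w)
      (sym (cong₂ (λ s t → y * s - x * t) (trans sumP (cong (u *_) det≡w)) (trans sumQ (cong (v *_) det≡w))))
    det[2a+b,a+b] : ∀ pa qa pb qb →
      (+ 2 * qa + qb) * (pa + pb) - (+ 2 * pa + pb) * (qa + qb) ≡ qa * pb - pa * qb
    det[2a+b,a+b] = solve-∀
    det[a+2b,a+b] : ∀ pa qa pb qb →
      (qa + + 2 * qb) * (pa + pb) - (pa + + 2 * pb) * (qa + qb) ≡ - (qa * pb - pa * qb)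
    det[a+2b,a+b] = solve-∀
    cross≡w : Q a * P b - P a * Q b ≡ w
    cross≡w = trans (sym (det-coords a b refl refl refl refl)) det≡w
    L-unimodular : (+ 2 * Q a + Q b) * u - (+ 2 * P a + P b) * v ≡ + 1
    L-unimodular = ℤ.*-cancelˡ-≡ w _ (+ 1) (begin
      w * ((+ 2 * Q a + Q b) * u - (+ 2 * P a + P b) * v)               ≡⟨ pairing (+ 2 * P a + P b) (+ 2 * Q a + Q b) ⟩
      (+ 2 * Q a + Q b) * (P a + P b) - (+ 2 * P a + P b) * (Q a + Q b) ≡⟨ det[2a+b,a+b] (P a) (Q a) (P b) (Q b) ⟩
      Q a * P b - P a * Q b                                             ≡⟨ cross≡w ⟩
      w                                                                 ≡⟨ ℤ.*-identityʳ w ⟨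
      w * + 1                                                           ∎)
    R-unimodular : (Q a + + 2 * Q b) * u - (P a + + 2 * P b) * v ≡ - + 1
    R-unimodular = ℤ.*-cancelˡ-≡ w _ (- + 1) (begin
      w * ((Q a + + 2 * Q b) * u - (P a + + 2 * P b) * v)               ≡⟨ pairing (P a + + 2 * P b) (Q a + + 2 * Q b) ⟩
      (Q a + + 2 * Q b) * (P a + P b) - (P a + + 2 * P b) * (Q a + Q b) ≡⟨ det[a+2b,a+b] (P a) (Q a) (P b) (Q b) ⟩
      - (Q a * P b - P a * Q b)                                         ≡⟨ cong -_ cross≡w ⟩
      - w                                                               ≡⟨ cong -_ (ℤ.*-identityʳ w) ⟨
      - (w * + 1)                                                       ≡⟨ ℤ.neg-distribʳ-* w (+ 1) ⟩
      w * - + 1                                                         ∎)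

  balanced-children : ∀ a b {w} .{{_ : ℤ.NonZero w}} → det a b ≡ w → Balanced a b →
    let L = left a b ; R = right a b in
    Link w Progressive a L × Link (+ 3 * w) Balanced L R × Link w Progressive R b
  balanced-children a b {w} det≡w balanced@(divides u sumP , divides v sumQ) =
      (det-aL , ∣-by u det-aL (diff-L (P a) (P b) u PL sumP)
              , ∣-by v det-aL (diff-L (Q a) (Q b) v QL sumQ))
    , (det-LR , ∣-by u det-LR (sum-LR (P a) (P b) u PL PR sumP)
              , ∣-by v det-LR (sum-LR (Q a) (Q b) v QL QR sumQ))
    , (det-Rb , ∣-by (- u) det-Rb (diff-R (P a) (P b) u PR sumP)
              , ∣-by (- v) det-Rb (diff-R (Q a) (Q b) v QR sumQ))
    where
    L R : Frac
    L = left a b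
    R = right a b
    PL : P L ≡ + 2 * P a + P b
    PL = proj₁ (proj₁ (balanced-inserted a b det≡w balanced))
    QL : Q L ≡ + 2 * Q a + Q b
    QL = proj₂ (proj₁ (balanced-inserted a b det≡w balanced))
    PR : P R ≡ P a + + 2 * P b
    PR = proj₁ (proj₂ (balanced-inserted a b det≡w balanced))
    QR : Q R ≡ Q a + + 2 * Q b
    QR = proj₂ (proj₂ (balanced-inserted a b det≡w balanced))
    cross≡w : Q a * P b - P a * Q b ≡ w
    cross≡w = trans (sym (det-coords a b refl refl refl refl)) det≡w
    det[a,2a+b] : ∀ pa qa pb qb → qa * (+ 2 * pa + pb) - pa * (+ 2 * qa + qb) ≡ qa * pb - pa * qb
    det[a,2a+b] = solve-∀
    det[2a+b,a+2b] : ∀ pa qa pb qb →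
      (+ 2 * qa + qb) * (pa + + 2 * pb) - (+ 2 * pa + pb) * (qa + + 2 * qb) ≡ + 3 * (qa * pb - pa * qb)
    det[2a+b,a+2b] = solve-∀
    det[a+2b,b] : ∀ pa qa pb qb → (qa + + 2 * qb) * pb - (pa + + 2 * pb) * qb ≡ qa * pb - pa * qb
    det[a+2b,b] = solve-∀
    det-aL : det a L ≡ w
    det-aL = trans (det-coords a L refl refl PL QL) (trans (det[a,2a+b] (P a) (Q a) (P b) (Q b)) cross≡w)
    det-LR : det L R ≡ + 3 * w
    det-LR = trans (det-coords L R PL QL PR QR)
      (trans (det[2a+b,a+2b] (P a) (Q a) (P b) (Q b)) (cong (+ 3 *_) cross≡w))
    det-Rb : det R b ≡ w
    det-Rb = trans (det-coords R b PR QR refl refl) (trans (det[a+2b,b] (P a) (Q a) (P b) (Q b)) cross≡w)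
    [2x+y]-x≡x+y : ∀ x y → (+ 2 * x + y) - x ≡ x + y
    [2x+y]-x≡x+y = solve-∀
    [2x+y]+[x+2y]≡3[x+y] : ∀ x y → (+ 2 * x + y) + (x + + 2 * y) ≡ + 3 * (x + y)
    [2x+y]+[x+2y]≡3[x+y] = solve-∀
    y-[x+2y]≡-[x+y] : ∀ x y → y - (x + + 2 * y) ≡ - (x + y)
    y-[x+2y]≡-[x+y] = solve-∀
    3[tw]≡t[3w] : ∀ t w → + 3 * (t * w) ≡ t * (+ 3 * w)
    3[tw]≡t[3w] = solve-∀
    diff-L : ∀ x y t {xL} → xL ≡ + 2 * x + y → x + y ≡ t * det a b → xL - x ≡ t * w
    diff-L x y t refl x+y≡td = trans ([2x+y]-x≡x+y x y) (trans x+y≡td (cong (t *_) det≡w))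
    sum-LR : ∀ x y t {xL xR} → xL ≡ + 2 * x + y → xR ≡ x + + 2 * y → x + y ≡ t * det a b →
      xL + xR ≡ t * (+ 3 * w)
    sum-LR x y t refl refl x+y≡td = trans ([2x+y]+[x+2y]≡3[x+y] x y)
      (trans (cong (+ 3 *_) (trans x+y≡td (cong (t *_) det≡w))) (3[tw]≡t[3w] t w))
    diff-R : ∀ x y t {xR} → xR ≡ x + + 2 * y → x + y ≡ t * det a b → y - xR ≡ (- t) * w
    diff-R x y t refl x+y≡td = trans (y-[x+2y]≡-[x+y] x y)
      (trans (cong -_ (trans x+y≡td (cong (t *_) det≡w))) (ℤ.neg-distribˡ-* t w))

open import Data.Nat using (_*_)

term : ℕ → ℕ → Frac
term n i = nth (SB n) i

Pair : (Frac → Frac → Set) → ℕ → ℕ → Set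
Pair R n i = R (term n i) (term n (suc i))

-- Positions in the refined sequence

length-step : ∀ x xs → length (step (x ∷ xs)) ≡ suc (3 * length xs)
length-step x [] = refl
length-step x (y ∷ ys) rewrite length-step y ys = cong suc (sym (ℕ.*-suc 3 (length ys)))

length-SB : ∀ n → length (SB n) ≡ suc (3 ^ n)
length-SB zero = refl
length-SB (suc n) with SB n | length-SB n
... | x ∷ xs | eq = trans (length-step x xs) (cong (λ m → suc (3 * m)) (ℕ.suc-injective eq))

head-step : ∀ x xs → nth (step (x ∷ xs)) 0 ≡ x
head-step x [] = refl
head-step x (_ ∷ _) = refl

-- Indexing by i * 3 rather than 3 * i lets suc i * 3 reduce to three successors.
nth-step : ∀ xs i → suc i < length xs → let a = nth xs i ; b = nth xs (suc i) in
    nth (step xs) (i * 3) ≡ a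
  × nth (step xs) (suc (i * 3)) ≡ left a b
  × nth (step xs) (suc (suc (i * 3))) ≡ right a b
  × nth (step xs) (suc (suc (suc (i * 3)))) ≡ b
nth-step (x ∷ []) zero (s≤s ())
nth-step (x ∷ y ∷ ys) zero _ = refl , refl , refl , head-step y ys
nth-step (x ∷ y ∷ ys) (suc i) (s≤s i<) = nth-step (y ∷ ys) i i<

on-children : ∀ n i → i < 3 ^ n → (R₀ R₁ R₂ : Frac → Frac → Set) →
  let a = term n i ; b = term n (suc i) in
  R₀ a (left a b) × R₁ (left a b) (right a b) × R₂ (right a b) b →
  Pair R₀ (suc n) (3 * i) × Pair R₁ (suc n) (suc (3 * i)) × Pair R₂ (suc n) (suc (suc (3 * i)))
on-children n i i< R₀ R₁ R₂ (r₀ , r₁ , r₂) rewrite ℕ.*-comm 3 i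
  with nth-step (SB n) i (subst (suc i <_) (sym (length-SB n)) (s≤s i<))
... | e₀ , e₁ , e₂ , e₃ =
  subst₂ R₀ (sym e₀) (sym e₁) r₀ , subst₂ R₁ (sym e₁) (sym e₂) r₁ , subst₂ R₂ (sym e₂) (sym e₃) r₂

balanced-pair-children : ∀ n i {w} → i < 3 ^ n → .{{_ : ℤ.NonZero w}} → C n i ≡ w →
  Pair Balanced n i →
    Pair (Link w Progressive) (suc n) (3 * i)
  × Pair (Link (+ 3 ℤ.* w) Balanced) (suc n) (suc (3 * i))
  × Pair (Link w Progressive) (suc n) (suc (suc (3 * i)))
balanced-pair-children n i i< C≡w balanced =
  on-children n i i< (Link _ Progressive) (Link _ Balanced) (Link _ Progressive)
    (balanced-children (term n i) (term n (suc i)) C≡w balanced)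

progressive-pair-children : ∀ n i {d} → i < 3 ^ n → .{{_ : ℤ.NonZero d}} → C n i ≡ + 3 ℤ.* d →
  Pair Progressive n i →
    Pair (Link d Progressive) (suc n) (3 * i)
  × Pair (Link d Progressive) (suc n) (suc (3 * i))
  × Pair (Link d Progressive) (suc n) (suc (suc (3 * i)))
progressive-pair-children n i i< C≡3d progressive =
  on-children n i i< (Link _ Progressive) (Link _ Progressive) (Link _ Progressive)
    (progressive-children (term n i) (term n (suc i)) C≡3d progressive)

-- Classification of the consecutive pairs

pow3 : ℕ → ℤ
pow3 k = + (3 ^ k)

pow3-nonZero : ∀ k → ℤ.NonZero (pow3 k)
pow3-nonZero k = ℕ.m^n≢0 3 k

pow3-suc : ∀ k → pow3 (suc k) ≡ + 3 ℤ.* pow3 k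
pow3-suc k = ℤ.pos-* 3 (3 ^ k)

pow3-< : ∀ {x y} k → x ≡ pow3 k → y ≡ pow3 (suc k) → x ℤ.< y
pow3-< k refl refl = ℤ.+<+ (ℕ.^-monoʳ-< 3 (s≤s (s≤s z≤n)) (ℕ.n<1+n k))

pow3-suc≢1 : ∀ k → pow3 (suc k) ≢ + 1
pow3-suc≢1 k eq = ℤ.<-irrefl (sym eq) (ℤ.+<+ (ℕ.^-monoʳ-< 3 (s≤s (s≤s z≤n)) {0} {suc k} (s≤s z≤n)))

strictLocalMax-between : ∀ n j → C n j ℤ.< C n (suc j) → C n (suc (suc j)) ℤ.< C n (suc j) →
  StrictLocalMax n (suc j)
strictLocalMax-between _ _ left< _ _ _ (inj₁ refl) = left<
strictLocalMax-between _ _ _ right< _ _ (inj₂ refl) = right<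

¬strictLocalMax : ∀ n i j → j < 3 ^ n → suc j ≡ i ⊎ j ≡ suc i → C n i ℤ.≤ C n j → ¬ StrictLocalMax n i
¬strictLocalMax _ _ j j< adjacent i≤j slm = ℤ.≤⇒≯ i≤j (slm j j< adjacent)

Raised : ℕ → ℕ → Set
Raised n i = C n i ≡ + 1 ⊎ StrictLocalMax n i

data Classified (n i : ℕ) : Set where
  peak  : ∀ k → C n i ≡ pow3 k → Pair Balanced n i → Raised n i → Classified n i
  slope : ∀ k → C n i ≡ pow3 (suc k) → Pair Progressive n i → ¬ Raised n i → Classified n i

classify-progressive : ∀ {n i} k → C n i ≡ pow3 k → Pair Progressive n i → ¬ StrictLocalMax n i →
  Classified n i
classify-progressive {n} {i} zero C≡1 _ _ =
  peak zero C≡1 (unit-balanced (term n i) (term n (suc i)) C≡1) (inj₁ C≡1)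
classify-progressive (suc k) C≡ progressive ¬slm = slope k C≡ progressive λ
  { (inj₁ C≡1) → pow3-suc≢1 k (trans (sym C≡) C≡1)
  ; (inj₂ slm) → ¬slm slm
  }

child-bounds : ∀ n i → i < 3 ^ n →
  3 * i < 3 ^ suc n × suc (3 * i) < 3 ^ suc n × suc (suc (3 * i)) < 3 ^ suc n
child-bounds n i i< = ℕ.<⇒≤ (ℕ.<⇒≤ last) , ℕ.<⇒≤ last , last
  where
  last : suc (suc (3 * i)) < 3 ^ suc n
  last = subst (_≤ 3 ^ suc n) (ℕ.*-suc 3 i) (ℕ.*-monoʳ-≤ 3 i<)

classified-children : ∀ {n i} → i < 3 ^ n → Classified n i →
  Classified (suc n) (3 * i) × Classified (suc n) (suc (3 * i)) × Classified (suc n) (suc (suc (3 * i)))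
classified-children {n} {i} i< (peak k C≡ balanced _) =
  let (c₀ , progressive₀) , (c₁ , balanced₁) , (c₂ , progressive₂) =
        balanced-pair-children n i i< {{pow3-nonZero k}} C≡ balanced
      c₁′ = trans c₁ (sym (pow3-suc k))
      _ , B₁ , _ = child-bounds n i i<
  in  classify-progressive k c₀ progressive₀
        (¬strictLocalMax (suc n) _ _ B₁ (inj₂ refl) (ℤ.<⇒≤ (pow3-< k c₀ c₁′)))
    , peak (suc k) c₁′ balanced₁ (inj₂ (strictLocalMax-between (suc n) _ (pow3-< k c₀ c₁′) (pow3-< k c₂ c₁′)))
    , classify-progressive k c₂ progressive₂
        (¬strictLocalMax (suc n) _ _ B₁ (inj₁ refl) (ℤ.<⇒≤ (pow3-< k c₂ c₁′)))
classified-children {n} {i} i< (slope k C≡ progressive _) =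
  let (c₀ , progressive₀) , (c₁ , progressive₁) , (c₂ , progressive₂) =
        progressive-pair-children n i i< {{pow3-nonZero k}} (trans C≡ (pow3-suc k)) progressive
      B₀ , B₁ , _ = child-bounds n i i<
  in  classify-progressive k c₀ progressive₀
        (¬strictLocalMax (suc n) _ _ B₁ (inj₂ refl) (ℤ.≤-reflexive (trans c₀ (sym c₁))))
    , classify-progressive k c₁ progressive₁
        (¬strictLocalMax (suc n) _ _ B₀ (inj₁ refl) (ℤ.≤-reflexive (trans c₁ (sym c₀))))
    , classify-progressive k c₂ progressive₂
        (¬strictLocalMax (suc n) _ _ B₁ (inj₁ refl) (ℤ.≤-reflexive (trans c₂ (sym c₁))))

data Ternary : ℕ → Set where
  digit₀ : ∀ q → Ternary (3 * q)
  digit₁ : ∀ q → Ternary (suc (3 * q))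
  digit₂ : ∀ q → Ternary (suc (suc (3 * q)))

ternary : ∀ i → Ternary i
ternary zero = digit₀ 0
ternary (suc i) with ternary i
... | digit₀ q = digit₁ q
... | digit₁ q = digit₂ q
... | digit₂ q = subst Ternary (ℕ.*-suc 3 q) (digit₀ (suc q))

quotient-bound : ∀ {q i N} → 3 * q ≤ i → i < 3 * N → q < N
quotient-bound 3q≤i i<3N = ℕ.*-cancelˡ-< 3 _ _ (ℕ.≤-<-trans 3q≤i i<3N)

classify : ∀ n i → i < 3 ^ n → Classified n i
classify zero zero _ = peak zero refl (unit-balanced (0 , 1) (1 , 1) refl) (inj₁ refl)
classify zero (suc i) (s≤s ())
classify (suc n) i i< with ternary i
... | digit₀ q = proj₁ (classified-children q< (classify n q q<))
  where
  q< : q < 3 ^ n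
  q< = quotient-bound ℕ.≤-refl i<
... | digit₁ q = proj₁ (proj₂ (classified-children q< (classify n q q<)))
  where
  q< : q < 3 ^ n
  q< = quotient-bound (ℕ.m≤n+m _ 1) i<
... | digit₂ q = proj₂ (proj₂ (classified-children q< (classify n q q<)))
  where
  q< : q < 3 ^ n
  q< = quotient-bound (ℕ.m≤n+m _ 2) i<

theorem15 : ∀ n i → i < 3 ^ n →
    ((C n i ≡ + 1 ⊎ StrictLocalMax n i) →
        (C (suc n) (3 * i) ≡ C n i)
      × (C (suc n) (suc (3 * i)) ≡ (+ 3) ℤ.* C n i)
      × (C (suc n) (suc (suc (3 * i))) ≡ C n i))
    × (¬ (C n i ≡ + 1 ⊎ StrictLocalMax n i) →
        ((+ 3) ℤ.* C (suc n) (3 * i) ≡ C n i)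
      × ((+ 3) ℤ.* C (suc n) (suc (3 * i)) ≡ C n i)
      × ((+ 3) ℤ.* C (suc n) (suc (suc (3 * i))) ≡ C n i))
theorem15 n i i< with classify n i i<
... | peak k C≡ balanced raised =
  let (c₀ , _) , (c₁ , _) , (c₂ , _) =
        balanced-pair-children n i i< {{subst ℤ.NonZero (sym C≡) (pow3-nonZero k)}} refl balanced
  in  (λ _ → c₀ , c₁ , c₂) , λ ¬raised → contradiction raised ¬raised
... | slope k C≡ progressive ¬raised =
  let C≡3d = trans C≡ (pow3-suc k)
      (c₀ , _) , (c₁ , _) , (c₂ , _) = progressive-pair-children n i i< {{pow3-nonZero k}} C≡3d progressive
      thrice : ∀ {x} → x ≡ pow3 k → + 3 ℤ.* x ≡ C n i
      thrice x≡ = trans (cong (+ 3 ℤ.*_) x≡) (sym C≡3d)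
  in  (λ raised → contradiction raised ¬raised) , λ _ → thrice c₀ , thrice c₁ , thrice c₂
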